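{- For every conditional formula $\phi$ and all sets $\Gamma,\Delta$ of modal formulas: $\Gamma\models_{\mathsf{CnK}}\Delta$ if and only if $Tr_\phi(\Gamma)\models_{\mathsf{CnCK}}Tr_\phi(\Delta)$. (That is, $\mathsf{CnK}$ is a modal companion of $\mathsf{CnCK}$.)
   Context: Modal formulas: built from propositional letters with $\wedge,\vee,\to,\sim$ (strong negation), $\Box,\Diamond$. Conditional formulas: built with $\wedge,\vee,\to,\sim$ and binary $\mathbin{\Box\!\!\to},\mathbin{\Diamond\!\!\to}$. For a conditional formula $\phi$, $Tr_\phi$ maps modal to conditional formulas: $Tr_\phi(p)=p$, $Tr_\phi(\sim\psi)=\sim Tr_\phi(\psi)$, $Tr_\phi(\psi\ast\chi)=Tr_\phi(\psi)\ast Tr_\phi(\chi)$ for $\ast\in\{\wedge,\vee,\to\}$, $Tr_\phi(\Box\psi)=\phi\mathbin{\Box\!\!\to}Tr_\phi(\psi)$, $Tr_\phi(\Diamond\psi)=\phi\mathbin{\Diamond\!\!\to}Tr_\phi(\psi)$; applied to sets pointwise. Propositional satisfaction clauses (common): $w\models^\pm p$ iff $w\in V^\pm(p)$; $\wedge$: $+$ iff both $+$, $-$ iff some $-$; $\vee$: $+$ iff some $+$, $-$ iff both $-$; $w\models^\pm\sim\psi$ iff $w\models^\mp\psi$; $w\models^+\psi\to\chi$ iff $\forall v\geq w(v\models^+\psi\Rightarrow v\models^+\chi)$; $w\models^-\psi\to\chi$ iff $\forall v\geq w(v\models^+\psi\Rightarrow v\models^-\chi)$. In all models $W\neq\emptyset$,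 $\leq$ is a preorder, $V^\pm$ map letters to $\leq$-upward closed sets. A relation $S\subseteq W\times W$ is Fischer-Servi if (c1) $w\leq w'$, $wSv$ imply $w'Sv'$, $v\leq v'$ for some $v'$; (c2) $wSv$, $v\leq v'$ imply $w\leq w'$, $w'Sv'$ for some $w'$. $\mathsf{CnK}$: models $(W,\leq,R,V^+,V^-)$ with $R\subseteq W\times W$ Fischer-Servi; $w\models^\pm\Box\psi$ iff $\forall v\geq w\,\forall u(vRu\Rightarrow u\models^\pm\psi)$; $w\models^\pm\Diamond\psi$ iff $\exists u(wRu$ and $u\models^\pm\psi)$. $\mathsf{CnCK}$: models $(W,\leq,R,V^+,V^-)$ with $R\subseteq W\times(\mathcal{P}(W))^2\times W$ such that each $R_{(X,Y)}=\{(w,v)\mid R(w,(X,Y),v)\}$ is Fischer-Servi; with $\|\psi\|=(\{w\mid w\models^+\psi\},\{w\mid w\models^-\psi\})$: $w\models^\pm\psi\mathbin{\Box\!\!\to}\chi$ iff $\forall v\geq w\,\forall u(vR_{\|\psi\|}u\Rightarrow u\models^\pm\chi)$; $w\models^\pm\psi\mathbin{\Diamond\!\!\to}\chi$ iff $\exists u(wR_{\|\psi\|}u$ and $u\models^\pm\chi)$. In each logic, $\Gamma\models\Delta$ iff no world of any model verifies ($\models^+$) all of $\Gamma$ and none of $\Delta$. -}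

module Defs where

open import Data.Nat using (ℕ)
open import Data.Product using (Σ; _×_; _,_; ∃)
open import Data.Sum using (_⊎_)
open import Data.Empty using (⊥)
open import Relation.Nullary using (¬_)
open import Relation.Binary.PropositionalEquality using (_≡_)
open import Level using (Level; suc; _⊔_) renaming (zero to lzero)

Letter : Set
Letter = ℕ

Pred : Set → Set₁
Pred A = A → Set

data MForm : Set where
  var  : Letter → MForm
  _∧_  : MForm → MForm → MForm
  _∨_  : MForm → MForm → MForm
  _⇒_  : MForm → MForm → MForm
  ∼_   : MForm → MForm
  □_   : MForm → MForm
  ◇_   : MForm → MForm

data CForm : Set where
  var  : Letter → CForm
  _∧_  : CForm → CForm → CForm
  _∨_  : CForm → CForm → CForm
  _⇒_  : CForm → CForm → CForm
  ∼_   : CForm → CForm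
  _□→_ : CForm → CForm → CForm
  _◇→_ : CForm → CForm → CForm

Tr : CForm → MForm → CForm
Tr φ (var p)  = var p
Tr φ (ψ ∧ χ)  = Tr φ ψ ∧ Tr φ χ
Tr φ (ψ ∨ χ)  = Tr φ ψ ∨ Tr φ χ
Tr φ (ψ ⇒ χ)  = Tr φ ψ ⇒ Tr φ χ
Tr φ (∼ ψ)    = ∼ Tr φ ψ
Tr φ (□ ψ)    = φ □→ Tr φ ψ
Tr φ (◇ ψ)    = φ ◇→ Tr φ ψ

TrSet : CForm → Pred MForm → Pred CForm
TrSet φ Γ χ = Σ MForm λ ψ → Γ ψ × (Tr φ ψ ≡ χ)

FischerServi : {W : Set} → (W → W → Set) → (W → W → Set) → Set
FischerServi {W} _≤_ S =
  (∀ {w w′ v} → w ≤ w′ → S w v → Σ W λ v′ → S w′ v′ × (v ≤ v′)) ×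
  (∀ {w v v′} → S w v → v ≤ v′ → Σ W λ w′ → (w ≤ w′) × S w′ v′)

UpClosed : {W : Set} → (W → W → Set) → Pred W → Set
UpClosed {W} _≤_ X = ∀ {w v} → w ≤ v → X w → X v

record Base : Set₁ where
  field
    W      : Set
    inhab  : W
    _≤_    : W → W → Set
    ≤-refl : ∀ {w} → w ≤ w
    ≤-trans : ∀ {u v w} → u ≤ v → v ≤ w → u ≤ w
    V⁺ V⁻  : Letter → Pred W
    V⁺-up  : ∀ p → UpClosed _≤_ (V⁺ p)
    V⁻-up  : ∀ p → UpClosed _≤_ (V⁻ p)

record CnKModel : Set₁ where
  field
    base : Base
  open Base base public
  field
    R   : W → W → Set
    R-FS : FischerServi _≤_ R

-- CnCK models. Subsets of W are predicates; R is required to depend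
-- on the pair (X , Y) only up to extensional equality of the subsets.
_≐_ : {W : Set} → Pred W → Pred W → Set
X ≐ Y = ∀ w → (X w → Y w) × (Y w → X w)

record CnCKModel : Set₁ where
  field
    base : Base
  open Base base public
  field
    R    : Pred W → Pred W → W → W → Set
    R-FS : ∀ X Y → FischerServi _≤_ (R X Y)
    R-ext : ∀ {X X′ Y Y′} → X ≐ X′ → Y ≐ Y′ → ∀ w v → R X Y w v → R X′ Y′ w v

module CnKSat (M : CnKModel) where
  open CnKModel M
  mutual
    _⊨⁺_ : W → MForm → Set
    w ⊨⁺ var p = V⁺ p w
    w ⊨⁺ (ψ ∧ χ) = (w ⊨⁺ ψ) × (w ⊨⁺ χ)
    w ⊨⁺ (ψ ∨ χ) = (w ⊨⁺ ψ) ⊎ (w ⊨⁺ χ)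
    w ⊨⁺ (ψ ⇒ χ) = ∀ v → w ≤ v → v ⊨⁺ ψ → v ⊨⁺ χ
    w ⊨⁺ (∼ ψ) = w ⊨⁻ ψ
    w ⊨⁺ (□ ψ) = ∀ v → w ≤ v → ∀ u → R v u → u ⊨⁺ ψ
    w ⊨⁺ (◇ ψ) = Σ W λ u → R w u × (u ⊨⁺ ψ)

    _⊨⁻_ : W → MForm → Set
    w ⊨⁻ var p = V⁻ p w
    w ⊨⁻ (ψ ∧ χ) = (w ⊨⁻ ψ) ⊎ (w ⊨⁻ χ)
    w ⊨⁻ (ψ ∨ χ) = (w ⊨⁻ ψ) × (w ⊨⁻ χ)
    w ⊨⁻ (ψ ⇒ χ) = ∀ v → w ≤ v → v ⊨⁺ ψ → v ⊨⁻ χ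
    w ⊨⁻ (∼ ψ) = w ⊨⁺ ψ
    w ⊨⁻ (□ ψ) = ∀ v → w ≤ v → ∀ u → R v u → u ⊨⁻ ψ
    w ⊨⁻ (◇ ψ) = Σ W λ u → R w u × (u ⊨⁻ ψ)

module CnCKSat (M : CnCKModel) where
  open CnCKModel M
  mutual
    _⊨⁺_ : W → CForm → Set
    w ⊨⁺ var p = V⁺ p w
    w ⊨⁺ (ψ ∧ χ) = (w ⊨⁺ ψ) × (w ⊨⁺ χ)
    w ⊨⁺ (ψ ∨ χ) = (w ⊨⁺ ψ) ⊎ (w ⊨⁺ χ)
    w ⊨⁺ (ψ ⇒ χ) = ∀ v → w ≤ v → v ⊨⁺ ψ → v ⊨⁺ χ
    w ⊨⁺ (∼ ψ) = w ⊨⁻ ψ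
    w ⊨⁺ (ψ □→ χ) = ∀ v → w ≤ v → ∀ u → R (λ x → x ⊨⁺ ψ) (λ x → x ⊨⁻ ψ) v u → u ⊨⁺ χ
    w ⊨⁺ (ψ ◇→ χ) = Σ W λ u → R (λ x → x ⊨⁺ ψ) (λ x → x ⊨⁻ ψ) w u × (u ⊨⁺ χ)

    _⊨⁻_ : W → CForm → Set
    w ⊨⁻ var p = V⁻ p w
    w ⊨⁻ (ψ ∧ χ) = (w ⊨⁻ ψ) ⊎ (w ⊨⁻ χ)
    w ⊨⁻ (ψ ∨ χ) = (w ⊨⁻ ψ) × (w ⊨⁻ χ)
    w ⊨⁻ (ψ ⇒ χ) = ∀ v → w ≤ v → v ⊨⁺ ψ → v ⊨⁻ χ
    w ⊨⁻ (∼ ψ) = w ⊨⁺ ψ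
    w ⊨⁻ (ψ □→ χ) = ∀ v → w ≤ v → ∀ u → R (λ x → x ⊨⁺ ψ) (λ x → x ⊨⁻ ψ) v u → u ⊨⁻ χ
    w ⊨⁻ (ψ ◇→ χ) = Σ W λ u → R (λ x → x ⊨⁺ ψ) (λ x → x ⊨⁻ ψ) w u × (u ⊨⁻ χ)

_⊨CnK_ : Pred MForm → Pred MForm → Set₁
Γ ⊨CnK Δ = ¬ (Σ CnKModel λ M → let open CnKModel M; open CnKSat M in
   Σ W λ w → (∀ ψ → Γ ψ → w ⊨⁺ ψ) × (∀ ψ → Δ ψ → ¬ (w ⊨⁺ ψ)))

_⊨CnCK_ : Pred CForm → Pred CForm → Set₁
Γ ⊨CnCK Δ = ¬ (Σ CnCKModel λ M → let open CnCKModel M; open CnCKSat M in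
   Σ W λ w → (∀ ψ → Γ ψ → w ⊨⁺ ψ) × (∀ ψ → Δ ψ → ¬ (w ⊨⁺ ψ)))

{-# OPTIONS --safe #-}
module Submission where

open import Defs
open import Data.Product using (_×_; _,_)
open import Data.Sum using (inj₁; inj₂)
open import Relation.Nullary using (¬_)
open import Relation.Binary.PropositionalEquality using (refl)

-- Fixing the antecedent φ turns a CnCK model into a CnK model with accessibility
-- R_‖φ‖, and Tr φ ψ holds in the former exactly where ψ holds in the latter.  Every
-- CnK model arises in this way (up to record η, so definitionally), from the CnCK
-- model whose R ignores the antecedent.  So countermodels are carried back and
-- forth at the same world.

antecedentModel : CForm → CnCKModel → CnKModel
antecedentModel φ N = record
  { base = base ; R = R (λ x → x ⊨⁺ φ) (λ x → x ⊨⁻ φ) ; R-FS = R-FS _ _ }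
  where open CnCKModel N
        open CnCKSat N

constantModel : CnKModel → CnCKModel
constantModel M = record
  { base = base ; R = λ _ _ → R ; R-FS = λ _ _ → R-FS ; R-ext = λ _ _ _ _ r → r }
  where open CnKModel M

RefutesCnK : (M : CnKModel) → CnKModel.W M → Pred MForm → Pred MForm → Set
RefutesCnK M w Γ Δ = (∀ ψ → Γ ψ → w ⊨⁺ ψ) × (∀ ψ → Δ ψ → ¬ (w ⊨⁺ ψ))
  where open CnKSat M

RefutesCnCK : (N : CnCKModel) → CnCKModel.W N → Pred CForm → Pred CForm → Set
RefutesCnCK N w Γ Δ = (∀ χ → Γ χ → w ⊨⁺ χ) × (∀ χ → Δ χ → ¬ (w ⊨⁺ χ))
  where open CnCKSat N

module _ (φ : CForm) (N : CnCKModel) where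
  private
    module C = CnCKSat N
    module K = CnKSat (antecedentModel φ N)

  mutual
    fromTr⁺ : ∀ ψ w → w C.⊨⁺ Tr φ ψ → w K.⊨⁺ ψ
    fromTr⁺ (var p) w h = h
    fromTr⁺ (ψ ∧ χ) w (a , b) = fromTr⁺ ψ w a , fromTr⁺ χ w b
    fromTr⁺ (ψ ∨ χ) w (inj₁ a) = inj₁ (fromTr⁺ ψ w a)
    fromTr⁺ (ψ ∨ χ) w (inj₂ b) = inj₂ (fromTr⁺ χ w b)
    fromTr⁺ (ψ ⇒ χ) w h v w≤v a = fromTr⁺ χ v (h v w≤v (toTr⁺ ψ v a))
    fromTr⁺ (∼ ψ) w h = fromTr⁻ ψ w h
    fromTr⁺ (□ ψ) w h v w≤v u r = fromTr⁺ ψ u (h v w≤v u r)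
    fromTr⁺ (◇ ψ) w (u , r , a) = u , r , fromTr⁺ ψ u a

    toTr⁺ : ∀ ψ w → w K.⊨⁺ ψ → w C.⊨⁺ Tr φ ψ
    toTr⁺ (var p) w h = h
    toTr⁺ (ψ ∧ χ) w (a , b) = toTr⁺ ψ w a , toTr⁺ χ w b
    toTr⁺ (ψ ∨ χ) w (inj₁ a) = inj₁ (toTr⁺ ψ w a)
    toTr⁺ (ψ ∨ χ) w (inj₂ b) = inj₂ (toTr⁺ χ w b)
    toTr⁺ (ψ ⇒ χ) w h v w≤v a = toTr⁺ χ v (h v w≤v (fromTr⁺ ψ v a))
    toTr⁺ (∼ ψ) w h = toTr⁻ ψ w h
    toTr⁺ (□ ψ) w h v w≤v u r = toTr⁺ ψ u (h v w≤v u r)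
    toTr⁺ (◇ ψ) w (u , r , a) = u , r , toTr⁺ ψ u a

    fromTr⁻ : ∀ ψ w → w C.⊨⁻ Tr φ ψ → w K.⊨⁻ ψ
    fromTr⁻ (var p) w h = h
    fromTr⁻ (ψ ∧ χ) w (inj₁ a) = inj₁ (fromTr⁻ ψ w a)
    fromTr⁻ (ψ ∧ χ) w (inj₂ b) = inj₂ (fromTr⁻ χ w b)
    fromTr⁻ (ψ ∨ χ) w (a , b) = fromTr⁻ ψ w a , fromTr⁻ χ w b
    fromTr⁻ (ψ ⇒ χ) w h v w≤v a = fromTr⁻ χ v (h v w≤v (toTr⁺ ψ v a))
    fromTr⁻ (∼ ψ) w h = fromTr⁺ ψ w h
    fromTr⁻ (□ ψ) w h v w≤v u r = fromTr⁻ ψ u (h v w≤v u r)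
    fromTr⁻ (◇ ψ) w (u , r , a) = u , r , fromTr⁻ ψ u a

    toTr⁻ : ∀ ψ w → w K.⊨⁻ ψ → w C.⊨⁻ Tr φ ψ
    toTr⁻ (var p) w h = h
    toTr⁻ (ψ ∧ χ) w (inj₁ a) = inj₁ (toTr⁻ ψ w a)
    toTr⁻ (ψ ∧ χ) w (inj₂ b) = inj₂ (toTr⁻ χ w b)
    toTr⁻ (ψ ∨ χ) w (a , b) = toTr⁻ ψ w a , toTr⁻ χ w b
    toTr⁻ (ψ ⇒ χ) w h v w≤v a = toTr⁻ χ v (h v w≤v (fromTr⁺ ψ v a))
    toTr⁻ (∼ ψ) w h = toTr⁺ ψ w h
    toTr⁻ (□ ψ) w h v w≤v u r = toTr⁻ ψ u (h v w≤v u r)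
    toTr⁻ (◇ ψ) w (u , r , a) = u , r , toTr⁻ ψ u a

  refutesCnK-fromTr : ∀ {Γ Δ} w →
    RefutesCnCK N w (TrSet φ Γ) (TrSet φ Δ) → RefutesCnK (antecedentModel φ N) w Γ Δ
  refutesCnK-fromTr w (⊨Γ , ⊭Δ) =
    (λ ψ ψ∈Γ → fromTr⁺ ψ w (⊨Γ (Tr φ ψ) (ψ , ψ∈Γ , refl))) ,
    (λ ψ ψ∈Δ ⊨ψ → ⊭Δ (Tr φ ψ) (ψ , ψ∈Δ , refl) (toTr⁺ ψ w ⊨ψ))

  refutesCnCK-toTr : ∀ {Γ Δ} w →
    RefutesCnK (antecedentModel φ N) w Γ Δ → RefutesCnCK N w (TrSet φ Γ) (TrSet φ Δ)
  refutesCnCK-toTr w (⊨Γ , ⊭Δ) =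
    (λ { _ (ψ , ψ∈Γ , refl) → toTr⁺ ψ w (⊨Γ ψ ψ∈Γ) }) ,
    (λ { _ (ψ , ψ∈Δ , refl) ⊨Trψ → ⊭Δ ψ ψ∈Δ (fromTr⁺ ψ w ⊨Trψ) })

proposition5p25 : (φ : CForm) (Γ Δ : Pred MForm) →
    ((Γ ⊨CnK Δ) → (TrSet φ Γ ⊨CnCK TrSet φ Δ)) × ((TrSet φ Γ ⊨CnCK TrSet φ Δ) → (Γ ⊨CnK Δ))
proposition5p25 φ Γ Δ =
  (λ Γ⊨Δ (N , w , refutes) → Γ⊨Δ (antecedentModel φ N , w , refutesCnK-fromTr φ N w refutes)) ,
  (λ TrΓ⊨TrΔ (M , w , refutes) →
     TrΓ⊨TrΔ (constantModel M , w , refutesCnCK-toTr φ (constantModel M) w refutes))
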